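{- Let $G=(V,E,\ell)$ be a tree with positive edge lengths $\ell$, let $T\subseteq V$ be a set of terminals, and let $(\mathcal{F},\delta)$ be any solution to the $0$-Extension with Steiner Nodes instance $(G,T,\ell)$, i.e. $\mathcal{F}$ is a partition of $V$ in which distinct terminals lie in distinct clusters, and $\delta$ is a semi-metric on $\mathcal{F}$ with $\delta(F(t),F(t'))=\mathrm{dist}_\ell(t,t')$ for all $t,t'\in T$ (here $F(u)$ is the cluster containing $u$). Let $(V^{\mathrm{con}},\ell^{\mathrm{con}})$ be the continuization of $G$. Then there exists a mapping $\phi:\mathcal{F}\to V^{\mathrm{con}}$ such that (i) for each terminal $t\in T$, $\phi(F(t))=t$; and (ii) for every pair $F,F'\in\mathcal{F}$, $\ell^{\mathrm{con}}(\phi(F),\phi(F'))\le\delta(F,F')$.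
   Context: $\mathrm{dist}_\ell$ is the shortest-path metric of $G$ under lengths $\ell$. The continuization $(V^{\mathrm{con}},\ell^{\mathrm{con}})$ of $G$: each edge $(u,v)$ is replaced by a continuous line segment of length $\ell_{(u,v)}$ between $u$ and $v$, whose points are $(u,\alpha)=(v,\ell_{(u,v)}-\alpha)$ for $0\le\alpha\le\ell_{(u,v)}$; $V^{\mathrm{con}}$ is the union of all these segments (so $V\subseteq V^{\mathrm{con}}$). For two points on the same segment, $(u,\alpha),(u,\alpha')$, $\ell^{\mathrm{con}}=|\alpha-\alpha'|$; for $p=(u,\alpha)$ on segment $(u,v)$ and $p'=(u',\alpha')$ on segment $(u',v')$, $\ell^{\mathrm{con}}(p,p')$ is the minimum of $\mathrm{dist}_\ell(u,u')+\alpha+\alpha'$, $\mathrm{dist}_\ell(u,v')+\alpha+(\ell_{(u',v')}-\alpha')$, $\mathrm{dist}_\ell(v,u')+(\ell_{(u,v)}-\alpha)+\alpha'$, and $\mathrm{dist}_\ell(v,v')+(\ell_{(u,v)}-\alpha)+(\ell_{(u',v')}-\alpha')$. -}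

module Defs where

open import Data.Nat using (ℕ; suc)
open import Data.Fin using (Fin; _≟_)
open import Data.Product using (Σ; ∃; _×_; _,_; proj₁; proj₂)
open import Data.Sum using (_⊎_)
open import Relation.Binary.PropositionalEquality using (_≡_; _≢_)
open import Relation.Binary.Structures using (IsTotalOrder)
open import Relation.Binary.Definitions using (Decidable)
open import Relation.Nullary using (yes; no)
open import Algebra.Structures using (IsCommutativeRing)

-- The real numbers, axiomatised as a (Dedekind-)complete ordered field.
-- Every model of these axioms is (classically) isomorphic to ℝ.

record RealField : Set₁ where
  infixl 6 _+_
  infixl 7 _*_
  infix 4 _≤_
  field
    ℝ                 : Set
    _+_ _*_           : ℝ → ℝ → ℝ
    -_                : ℝ → ℝ
    0# 1#             : ℝ
    _≤_               : ℝ → ℝ → Set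
    isCommutativeRing : IsCommutativeRing _≡_ _+_ _*_ -_ 0# 1#
    0≢1               : 0# ≢ 1#
    inverse           : ∀ x → x ≢ 0# → ∃ λ y → x * y ≡ 1#
    isTotalOrder      : IsTotalOrder _≡_ _≤_
    _≤?_              : Decidable _≤_
    +-monoˡ-≤         : ∀ {x y} z → x ≤ y → x + z ≤ y + z
    *-nonneg          : ∀ {x y} → 0# ≤ x → 0# ≤ y → 0# ≤ x * y
    sup               : (S : ℝ → Set) → ∃ S → (∃ λ b → ∀ x → S x → x ≤ b) →
                        ∃ λ s → (∀ x → S x → x ≤ s) ×
                                (∀ b → (∀ x → S x → x ≤ b) → s ≤ b)

open RealField {{...}} public

module _ {{R : RealField}} where

  infix 4 _<_
  _<_ : ℝ → ℝ → Set
  x < y = x ≤ y × x ≢ y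

  _-_ : ℝ → ℝ → ℝ
  x - y = x + (- y)

  _⊓_ : ℝ → ℝ → ℝ
  x ⊓ y with x ≤? y
  ... | yes _ = x
  ... | no  _ = y

  ∣_∣ : ℝ → ℝ
  ∣ x ∣ with 0# ≤? x
  ... | yes _ = x
  ... | no  _ = - x

  record WGraph (n m : ℕ) : Set where
    field
      ends : Fin m → Fin n × Fin n
      len  : Fin m → ℝ

  module _ {n m : ℕ} (G : WGraph n m) where
    open WGraph G

    Joins : Fin m → Fin n → Fin n → Set
    Joins e v w = ends e ≡ (v , w) ⊎ ends e ≡ (w , v)

    data Walk (u : Fin n) : Fin n → ℝ → Set where
      []   : Walk u u 0#
      step : ∀ {v w d} → Walk u v d → (e : Fin m) → Joins e v w →
             Walk u w (d + len e)

    Dist : Fin n → Fin n → ℝ → Set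
    Dist u v d = Walk u v d × (∀ d' → Walk u v d' → d ≤ d')

    Connected : Set
    Connected = ∀ u v → ∃ λ d → Walk u v d

    PositiveLengths : Set
    PositiveLengths = ∀ e → 0# < len e

    IsTree : Set
    IsTree = Connected × suc m ≡ n

    -- The continuization V^con.  A point is either a vertex, or a point
    -- (a, α) on the segment of edge e with ends e = (a , b), 0 ≤ α ≤ ℓ_e,
    -- i.e. at distance α from a (and ℓ_e - α from b).
    data Point : Set where
      vtx    : Fin n → Point
      onEdge : (e : Fin m) (α : ℝ) → 0# ≤ α → α ≤ len e → Point

    seg : Point → Fin n × Fin n × ℝ × ℝ
    seg (vtx v)            = v , v , 0# , 0#
    seg (onEdge e α _ _)   = proj₁ (ends e) , proj₂ (ends e) , len e , α

    -- the point p is (identified with) the vertex t: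
    -- (u,0) = u and (u,ℓ) = (v,0) = v
    IsVertex : Point → Fin n → Set
    IsVertex (vtx u) t          = u ≡ t
    IsVertex (onEdge e α _ _) t =
      (proj₁ (ends e) ≡ t × α ≡ 0#) ⊎ (proj₂ (ends e) ≡ t × α ≡ len e)

    GenDist : Point → Point → ℝ → Set
    GenDist p p' x with seg p | seg p'
    ... | u , v , L , α | u' , v' , L' , α' =
      ∃ λ d₁ → ∃ λ d₂ → ∃ λ d₃ → ∃ λ d₄ →
        Dist u u' d₁ × Dist u v' d₂ × Dist v u' d₃ × Dist v v' d₄ ×
        x ≡ ((d₁ + α + α') ⊓ (d₂ + α + (L' - α')))
            ⊓ ((d₃ + (L - α) + α') ⊓ (d₄ + (L - α) + (L' - α')))

    ConDist : Point → Point → ℝ → Set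
    ConDist p@(onEdge e α _ _) p'@(onEdge e' α' _ _) x with e ≟ e'
    ... | yes _ = x ≡ ∣ α - α' ∣
    ... | no  _ = GenDist p p' x
    ConDist p p' x = GenDist p p' x

  -- semi-metric (pseudometric: zero distances between distinct points allowed)
  IsSemiMetric : {k : ℕ} → (Fin k → Fin k → ℝ) → Set
  IsSemiMetric δ =
    (∀ C → δ C C ≡ 0#) × (∀ C C' → 0# ≤ δ C C') ×
    (∀ C C' → δ C C' ≡ δ C' C) × (∀ C C' C'' → δ C C'' ≤ δ C C' + δ C' C'')

{-# OPTIONS --safe #-}
-- Root the tree at a vertex and let h be the height above the root, so that
-- dist(a, b) = h a + h b − 2 h(a ∧ b) with a ∧ b the meet of a and b.  A cluster C is sent to
-- the point at height s_C = max(0, max_t (h t − δ(C, F t))) on the root path of a terminal a_C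
-- attaining the maximum.  For C = F t one may take a_C = t and s_C = h t, because
-- δ(F t, F t') = dist(t, t') ≥ h t' − h t; hence φ(F t) = t.  Two such points are at distance at
-- most s + s' − 2 min(s, s', h(a ∧ a')).  When the minimum is s or s' this is |s − s'| ≤ δ(C, C'),
-- since C ↦ s_C is 1-Lipschitz by the triangle inequality; otherwise it equals
-- dist(a, a') − δ(C, F a) − δ(C', F a') ≤ δ(C, C'), again by the triangle inequality.
module Submission where

open import Defs
open import Data.Nat as ℕ using (ℕ; zero; suc)
open import Data.Integer as ℤ using (ℤ; -[1+_])
import Data.Integer.Properties as ℤ
import Data.Nat.Properties as ℕ
open import Data.Sign as Sign using (Sign)
import Data.Fin as Fin
open import Data.Fin using (Fin; _≟_; punchIn; punchOut)
open import Data.Fin.Properties using (any?; pigeonhole; <⇒≢; punchOut-injective; punchIn-injective; punchInᵢ≢i)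
import Data.Maybe as Maybe
open import Data.Product using (Σ; ∃; ∃₂; _×_; _,_; proj₁; proj₂; swap)
open import Data.Product.Properties using (≡-dec; ,-injective)
open import Data.Sum using (_⊎_; inj₁; inj₂)
open import Data.Empty using (⊥; ⊥-elim)
open import Relation.Nullary using (¬_; Dec; yes; no)
open import Relation.Nullary.Decidable using (dec⇒maybe; decidable-stable; _⊎-dec_; _×-dec_)
open import Relation.Binary.PropositionalEquality
open import Relation.Binary.Structures using (IsTotalOrder)
open import Relation.Binary.Bundles using (Poset)
import Relation.Binary.Reasoning.PartialOrder as PosetReasoning
open import Relation.Binary.Definitions using (DecidableEquality)
open import Algebra.Bundles using (CommutativeRing)
open import Algebra.Solver.Ring.AlmostCommutativeRing
  using (AlmostCommutativeRing; fromCommutativeRing; _-Raw-AlmostCommutative⟶_)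
import Algebra.Solver.Ring as RingSolver
import Algebra.Properties.Ring as RingProperties
import Algebra.Properties.Group as GroupProperties
import Algebra.Properties.AbelianGroup as AbelianGroupProperties
import Algebra.Properties.Semiring.Mult as SemiringMultiplication
import Algebra.Properties.CommutativeSemigroup as CommutativeSemigroupProperties

module _ {{R : RealField}} where

  ℝ-commutativeRing : CommutativeRing _ _
  ℝ-commutativeRing = record { isCommutativeRing = isCommutativeRing }

  open CommutativeRing ℝ-commutativeRing public
    using (+-comm; +-assoc; +-identityˡ; +-identityʳ; -‿inverseʳ)
  private
    module ℝ = CommutativeRing ℝ-commutativeRing
    module Mult = SemiringMultiplication ℝ.semiring
    module +-Properties = CommutativeSemigroupProperties ℝ.+-commutativeSemigroup
    module *-Properties = CommutativeSemigroupProperties ℝ.*-commutativeSemigroup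
  open RingProperties ℝ.ring using (-1*x≈-x)
  open GroupProperties ℝ.+-group using (ε⁻¹≈ε; ⁻¹-involutive)
  open AbelianGroupProperties ℝ.+-abelianGroup using (⁻¹-∙-comm)

  fromℕ : ℕ → ℝ
  fromℕ n = Mult._×_ n 1#

  -- The ring solver decides equality of coefficients, which ℝ cannot do by computation;
  -- so coefficients are taken in ℤ and interpreted along the canonical map ℤ → ℝ.
  fromℤ : ℤ → ℝ
  fromℤ (ℤ.+ n)  = fromℕ n
  fromℤ -[1+ n ] = - (fromℕ (suc n))

  private
    1+x-[1+y]≡x-y : ∀ x y → (1# + x) - (1# + y) ≡ x - y
    1+x-[1+y]≡x-y x y = begin
      (1# + x) + - (1# + y)     ≡⟨ cong ((1# + x) +_) (sym (⁻¹-∙-comm 1# y)) ⟩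
      (1# + x) + (- 1# + - y)   ≡⟨ +-Properties.interchange 1# x (- 1#) (- y) ⟩
      (1# + - 1#) + (x + - y)   ≡⟨ cong (_+ (x + - y)) (-‿inverseʳ 1#) ⟩
      0# + (x + - y)            ≡⟨ +-identityˡ _ ⟩
      x - y                     ∎
      where open ≡-Reasoning

    fromℤ-⊖ : ∀ m n → fromℤ (m ℤ.⊖ n) ≡ fromℕ m - fromℕ n
    fromℤ-⊖ zero    zero    = sym (-‿inverseʳ 0#)
    fromℤ-⊖ (suc m) zero    = sym (trans (cong (fromℕ (suc m) +_) ε⁻¹≈ε) (+-identityʳ _))
    fromℤ-⊖ zero    (suc n) = sym (+-identityˡ _)
    fromℤ-⊖ (suc m) (suc n) = begin
      fromℤ (suc m ℤ.⊖ suc n)         ≡⟨ cong fromℤ (ℤ.[1+m]⊖[1+n]≡m⊖n m n) ⟩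
      fromℤ (m ℤ.⊖ n)                 ≡⟨ fromℤ-⊖ m n ⟩
      fromℕ m - fromℕ n               ≡⟨ sym (1+x-[1+y]≡x-y _ _) ⟩
      fromℕ (suc m) - fromℕ (suc n)   ∎
      where open ≡-Reasoning

    fromℤ-+ : ∀ i j → fromℤ (i ℤ.+ j) ≡ fromℤ i + fromℤ j
    fromℤ-+ (ℤ.+ m)  (ℤ.+ n)  = Mult.×-homo-+ 1# m n
    fromℤ-+ (ℤ.+ m)  -[1+ n ] = fromℤ-⊖ m (suc n)
    fromℤ-+ -[1+ m ] (ℤ.+ n)  = trans (fromℤ-⊖ n (suc m)) (+-comm _ _)
    fromℤ-+ -[1+ m ] -[1+ n ] = begin
      - fromℕ (suc (suc (m ℕ.+ n)))          ≡⟨ cong (λ k → - fromℕ (suc k)) (sym (ℕ.+-suc m n)) ⟩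
      - fromℕ (suc m ℕ.+ suc n)              ≡⟨ cong -_ (Mult.×-homo-+ 1# (suc m) (suc n)) ⟩
      - (fromℕ (suc m) + fromℕ (suc n))      ≡⟨ sym (⁻¹-∙-comm _ _) ⟩
      - fromℕ (suc m) + - fromℕ (suc n)      ∎
      where open ≡-Reasoning

    sign : Sign → ℝ
    sign Sign.+ = 1#
    sign Sign.- = - 1#

    fromℤ-◃ : ∀ s n → fromℤ (s ℤ.◃ n) ≡ sign s * (fromℕ n)
    fromℤ-◃ s       zero    = sym (ℝ.zeroʳ _)
    fromℤ-◃ Sign.+ (suc n) = sym (ℝ.*-identityˡ _)
    fromℤ-◃ Sign.- (suc n) = sym (-1*x≈-x _)

    fromℤ-signAbs : ∀ i → fromℤ i ≡ sign (ℤ.sign i) * fromℕ ℤ.∣ i ∣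
    fromℤ-signAbs (ℤ.+ n)  = sym (ℝ.*-identityˡ _)
    fromℤ-signAbs -[1+ n ] = sym (-1*x≈-x _)

    sign-* : ∀ s t → sign (s Sign.* t) ≡ sign s * sign t
    sign-* Sign.+ t       = sym (ℝ.*-identityˡ _)
    sign-* Sign.- Sign.+ = sym (ℝ.*-identityʳ _)
    sign-* Sign.- Sign.- = sym (trans (-1*x≈-x _) (⁻¹-involutive 1#))

    fromℤ-* : ∀ i j → fromℤ (i ℤ.* j) ≡ fromℤ i * fromℤ j
    fromℤ-* i j = begin
      fromℤ (i ℤ.* j)                          ≡⟨ fromℤ-◃ (s Sign.* t) (m ℕ.* n) ⟩
      sign (s Sign.* t) * fromℕ (m ℕ.* n)      ≡⟨ cong₂ _*_ (sign-* s t) (Mult.×1-homo-* m n) ⟩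
      (sign s * sign t) * (fromℕ m * fromℕ n)  ≡⟨ *-Properties.interchange _ _ _ _ ⟩
      (sign s * fromℕ m) * (sign t * fromℕ n)  ≡⟨ sym (cong₂ _*_ (fromℤ-signAbs i) (fromℤ-signAbs j)) ⟩
      fromℤ i * fromℤ j                        ∎
      where
      open ≡-Reasoning
      s = ℤ.sign i
      t = ℤ.sign j
      m = ℤ.∣ i ∣
      n = ℤ.∣ j ∣

    fromℤ-neg : ∀ i → fromℤ (ℤ.- i) ≡ - fromℤ i
    fromℤ-neg (ℤ.+ zero)  = sym ε⁻¹≈ε
    fromℤ-neg (ℤ.+ suc n) = refl
    fromℤ-neg -[1+ n ]    = sym (⁻¹-involutive _)

  ℝ-almostCommutativeRing : AlmostCommutativeRing _ _
  ℝ-almostCommutativeRing = fromCommutativeRing ℝ-commutativeRing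

  fromℤ-morphism : ℤ.+-*-rawRing -Raw-AlmostCommutative⟶ ℝ-almostCommutativeRing
  fromℤ-morphism = record
    { ⟦_⟧ = fromℤ ; +-homo = fromℤ-+ ; *-homo = fromℤ-* ; -‿homo = fromℤ-neg
    ; 0-homo = refl ; 1-homo = +-identityʳ 1# }

  open RingSolver ℤ.+-*-rawRing ℝ-almostCommutativeRing fromℤ-morphism
    (λ i j → Maybe.map (cong fromℤ) (dec⇒maybe (i ℤ.≟ j))) public
    using (solve; _:=_; _:+_; _:-_; :-_; con)

  open IsTotalOrder isTotalOrder public
    using ()
    renaming (refl to ≤-refl; reflexive to ≤-reflexive; trans to ≤-trans; antisym to ≤-antisym; total to ≤-total)

  ℝ-poset : Poset _ _ _
  ℝ-poset = record { isPartialOrder = IsTotalOrder.isPartialOrder isTotalOrder }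

  module ≤-Reasoning = PosetReasoning ℝ-poset

  ≰⇒≥ : ∀ {x y : ℝ} → ¬ x ≤ y → y ≤ x
  ≰⇒≥ {x} {y} x≰y with ≤-total x y
  ... | inj₁ x≤y = ⊥-elim (x≰y x≤y)
  ... | inj₂ y≤x = y≤x

  -- Inequalities are proved by writing y − x as a sum of slacks of known inequalities
  -- (combined with _⊕_), the ring identity being left to the solver.
  ≤-by-slack : ∀ {x y p : ℝ} → 0# ≤ p → y ≡ x + p → x ≤ y
  ≤-by-slack {x} {p = p} 0≤p refl = subst₂ _≤_ (+-identityˡ x) (+-comm p x) (+-monoˡ-≤ x 0≤p)

  slack : ∀ {x y : ℝ} → x ≤ y → 0# ≤ y - x
  slack {x} x≤y = subst (_≤ _) (-‿inverseʳ x) (+-monoˡ-≤ (- x) x≤y)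

  x-0≡x : ∀ x → x - 0# ≡ x
  x-0≡x x = solve 1 (λ x → (x :- con ℤ.0ℤ) := x) refl x

  x-y≤x : ∀ {x y : ℝ} → 0# ≤ y → x - y ≤ x
  x-y≤x {x} {y} 0≤y = ≤-by-slack (slack 0≤y) (solve 2 (λ x y → x := ((x :- y) :+ (y :- con ℤ.0ℤ))) refl x y)

  +-monoʳ-≤ : ∀ z {x y : ℝ} → x ≤ y → z + x ≤ z + y
  +-monoʳ-≤ z {x} {y} x≤y = subst₂ _≤_ (+-comm x z) (+-comm y z) (+-monoˡ-≤ z x≤y)

  infixl 6 _⊕_
  _⊕_ : ∀ {x y : ℝ} → 0# ≤ x → 0# ≤ y → 0# ≤ x + y
  0≤x ⊕ 0≤y = ≤-trans 0≤y (≤-by-slack 0≤x (+-comm _ _))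

  1≰0 : ¬ 1# ≤ 0#
  1≰0 1≤0 = 0≢1 (≤-antisym 0≤1 1≤0)
    where
    0≤-1 : 0# ≤ - 1#
    0≤-1 = ≤-by-slack (slack 1≤0) (sym (trans (+-identityˡ _) (+-identityˡ _)))
    0≤1 : 0# ≤ 1#
    0≤1 = subst (0# ≤_) (trans (-1*x≈-x (- 1#)) (⁻¹-involutive 1#)) (*-nonneg 0≤-1 0≤-1)

  _≟ℝ_ : ∀ (x y : ℝ) → Dec (x ≡ y)
  x ≟ℝ y with x ≤? y | y ≤? x
  ... | yes x≤y | yes y≤x = yes (≤-antisym x≤y y≤x)
  ... | no x≰y  | _       = no λ x≡y → x≰y (≤-reflexive x≡y)
  ... | _       | no y≰x  = no λ x≡y → y≰x (≤-reflexive (sym x≡y))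

  -- Completeness yields this much classical logic: sup ({0} ∪ {1 | P}) ≤ 0 exactly when ¬ P.
  weak-excluded-middle : (P : Set) → ¬ P ⊎ ¬ ¬ P
  weak-excluded-middle P with sup S (0# , inj₁ refl) (1# , S≤1)
    where
    S : ℝ → Set
    S x = x ≡ 0# ⊎ (P × x ≡ 1#)
    S≤1 : ∀ x → S x → x ≤ 1#
    S≤1 x (inj₁ refl)       = ≰⇒≥ 1≰0
    S≤1 x (inj₂ (_ , refl)) = ≤-refl
  ... | s , upper , least with s ≤? 0#
  ... | yes s≤0 = inj₁ λ p → 1≰0 (≤-trans (upper 1# (inj₂ (p , refl))) s≤0)
  ... | no  s≰0 = inj₂ λ ¬p →
    s≰0 (least 0# λ { _ (inj₁ refl) → ≤-refl ; _ (inj₂ (p , _)) → ⊥-elim (¬p p) })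

  ⊓-≤ˡ : ∀ (x y : ℝ) → x ⊓ y ≤ x
  ⊓-≤ˡ x y with x ≤? y
  ... | yes _   = ≤-refl
  ... | no  x≰y = ≰⇒≥ x≰y

  ⊓-≤ʳ : ∀ (x y : ℝ) → x ⊓ y ≤ y
  ⊓-≤ʳ x y with x ≤? y
  ... | yes x≤y = x≤y
  ... | no  _   = ≤-refl

  ∣-∣-≤ : ∀ {x y : ℝ} → x ≤ y → - x ≤ y → ∣ x ∣ ≤ y
  ∣-∣-≤ {x} x≤y -x≤y with 0# ≤? x
  ... | yes _ = x≤y
  ... | no  _ = -x≤y

  argmax : ∀ {n} (P : Fin n → Set) → (∀ t → Dec (P t)) → (f : Fin n → ℝ) →
           (Σ (Fin n) λ t → P t × (∀ t' → P t' → f t' ≤ f t)) ⊎ (∀ t → ¬ P t)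
  argmax {zero}  P P? f = inj₂ λ ()
  argmax {suc n} P P? f with argmax (λ i → P (Fin.suc i)) (λ i → P? (Fin.suc i)) (λ i → f (Fin.suc i)) | P? Fin.zero
  ... | inj₂ none           | yes p₀ =
    inj₁ (Fin.zero , p₀ , λ { Fin.zero _ → ≤-refl ; (Fin.suc i) p → ⊥-elim (none i p) })
  ... | inj₂ none           | no ¬p₀ =
    inj₂ λ { Fin.zero → ¬p₀ ; (Fin.suc i) → none i }
  ... | inj₁ (i , pᵢ , max) | no ¬p₀ =
    inj₁ (Fin.suc i , pᵢ , λ { Fin.zero p → ⊥-elim (¬p₀ p) ; (Fin.suc j) p → max j p })
  ... | inj₁ (i , pᵢ , max) | yes p₀ with f Fin.zero ≤? f (Fin.suc i)
  ...   | yes f₀≤fᵢ =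
    inj₁ (Fin.suc i , pᵢ , λ { Fin.zero _ → f₀≤fᵢ ; (Fin.suc j) p → max j p })
  ...   | no  f₀≰fᵢ =
    inj₁ (Fin.zero , p₀ , λ { Fin.zero _ → ≤-refl ; (Fin.suc j) p → ≤-trans (max j p) (≰⇒≥ f₀≰fᵢ) })

  sum-minus-twice-min-≤ : ∀ {s s' g b : ℝ} → s' - s ≤ b → s - s' ≤ b →
                          (¬ s ≤ g → ¬ s' ≤ g → (s + s') - (g + g) ≤ b) →
                          ∃ λ μ → μ ≤ s × μ ≤ s' × μ ≤ g × (s + s') - (μ + μ) ≤ b
  sum-minus-twice-min-≤ {s} {s'} {g} s'-s≤b s-s'≤b at-g with s ≤? s' | s ≤? g | s' ≤? g
  ... | yes s≤s' | yes s≤g | _ =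
    s , ≤-refl , s≤s' , s≤g ,
    subst (_≤ _) (solve 2 (λ x y → (y :- x) := ((x :+ y) :- (x :+ x))) refl s s') s'-s≤b
  ... | no  s≰s' | _ | yes s'≤g =
    s' , ≰⇒≥ s≰s' , ≤-refl , s'≤g ,
    subst (_≤ _) (solve 2 (λ x y → (x :- y) := ((x :+ y) :- (y :+ y))) refl s s') s-s'≤b
  ... | yes s≤s' | no s≰g | _ =
    g , ≰⇒≥ s≰g , ≤-trans (≰⇒≥ s≰g) s≤s' , ≤-refl ,
    at-g s≰g (λ s'≤g → s≰g (≤-trans s≤s' s'≤g))
  ... | no  s≰s' | _ | no s'≰g =
    g , ≤-trans (≰⇒≥ s'≰g) (≰⇒≥ s≰s') , ≰⇒≥ s'≰g , ≤-refl ,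
    at-g (λ s≤g → s'≰g (≤-trans (≰⇒≥ s≰s') s≤g)) s'≰g

module SemiMetric {{R : RealField}} {k : ℕ} {δ : Fin k → Fin k → ℝ} (metric : IsSemiMetric δ) where

  δ-refl : ∀ x → δ x x ≡ 0#
  δ-refl = proj₁ metric

  δ-nonneg : ∀ x y → 0# ≤ δ x y
  δ-nonneg = proj₁ (proj₂ metric)

  δ-sym : ∀ x y → δ x y ≡ δ y x
  δ-sym = proj₁ (proj₂ (proj₂ metric))

  δ-triangle : ∀ x y z → δ x z ≤ δ x y + δ y z
  δ-triangle = proj₂ (proj₂ (proj₂ metric))

  δ-reverse-triangle : ∀ x y z → δ x z - δ y z ≤ δ x y
  δ-reverse-triangle x y z = ≤-by-slack (slack (δ-triangle x y z))
    (solve 3 (λ a b c → c := ((a :- b) :+ ((c :+ b) :- a))) refl (δ x z) (δ y z) (δ x y))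

  δ-triangle₃ : ∀ x y z w → δ x w ≤ δ x y + δ y z + δ z w
  δ-triangle₃ x y z w = begin
    δ x w                       ≤⟨ δ-triangle x y w ⟩
    δ x y + δ y w               ≤⟨ +-monoʳ-≤ (δ x y) (δ-triangle y z w) ⟩
    δ x y + (δ y z + δ z w)     ≡⟨ sym (+-assoc _ _ _) ⟩
    δ x y + δ y z + δ z w       ∎
    where open ≤-Reasoning

module Walks {{R : RealField}} {n m : ℕ} (G : WGraph n m) where
  open WGraph G

  Joins-sym : ∀ {e v w} → Joins G e v w → Joins G e w v
  Joins-sym (inj₁ p) = inj₂ p
  Joins-sym (inj₂ p) = inj₁ p

  Joins? : ∀ e v w → Dec (Joins G e v w)
  Joins? e v w = (ends e ≟₂ (v , w)) ⊎-dec (ends e ≟₂ (w , v))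
    where
    _≟₂_ : DecidableEquality (Fin n × Fin n)
    _≟₂_ = ≡-dec _≟_ _≟_

  Joins-unique : ∀ {e a b c d} → Joins G e a b → Joins G e c d → (a ≡ c × b ≡ d) ⊎ (a ≡ d × b ≡ c)
  Joins-unique (inj₁ p) (inj₁ q) = inj₁ (,-injective (trans (sym p) q))
  Joins-unique (inj₁ p) (inj₂ q) = inj₂ (,-injective (trans (sym p) q))
  Joins-unique (inj₂ p) (inj₁ q) = inj₂ (swap (,-injective (trans (sym p) q)))
  Joins-unique (inj₂ p) (inj₂ q) = inj₁ (swap (,-injective (trans (sym p) q)))

  walk-cast : ∀ {u v d d'} → d ≡ d' → Walk G u v d → Walk G u v d'
  walk-cast = subst (Walk G _ _)

  edgeCount : ∀ {u v d} → Walk G u v d → ℕ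
  edgeCount []           = 0
  edgeCount (step W _ _) = suc (edgeCount W)

  prepend : ∀ {u v w d} e → Joins G e u v → Walk G v w d → Walk G u w (len e + d)
  prepend e j []             = walk-cast (+-comm _ _) (step [] e j)
  prepend e j (step W e' j') = walk-cast (+-assoc _ _ _) (step (prepend e j W) e' j')

  reverse : ∀ {u v d} → Walk G u v d → Walk G v u d
  reverse []           = []
  reverse (step W e j) = walk-cast (+-comm _ _) (prepend e (Joins-sym j) (reverse W))

  infixr 5 _++_
  _++_ : ∀ {u v w d d'} → Walk G u v d → Walk G v w d' → Walk G u w (d + d')
  W ++ []            = walk-cast (sym (+-identityʳ _)) W
  W ++ step W' e j   = walk-cast (+-assoc _ _ _) (step (W ++ W') e j)

  Dist-unique : ∀ {u v d d'} → Dist G u v d → Dist G u v d' → d ≡ d'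
  Dist-unique (W , shortest) (W' , shortest') = ≤-antisym (shortest _ W') (shortest' _ W)

module Continuization {{R : RealField}} {n m : ℕ} (G : WGraph n m) where
  open WGraph G

  ConDistAtMost : Point G → Point G → ℝ → Set
  ConDistAtMost p p' b = ∃ λ x → ConDist G p p' x × x ≤ b

  ConDistAtMost-weaken : ∀ {p p' b b'} → ConDistAtMost p p' b → b ≤ b' → ConDistAtMost p p' b'
  ConDistAtMost-weaken (x , d , x≤b) b≤b' = x , d , ≤-trans x≤b b≤b'

  ConDist-sameEdge : ∀ {e α lo hi α' lo' hi'} →
                     ConDist G (onEdge e α lo hi) (onEdge e α' lo' hi') ∣ α - α' ∣
  ConDist-sameEdge {e} with e ≟ e
  ... | yes _   = refl
  ... | no  e≢e = ⊥-elim (e≢e refl)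

  ConDist-vtx-self : ∀ {v} → Dist G v v 0# → ConDistAtMost (vtx v) (vtx v) 0#
  ConDist-vtx-self d = _ , (_ , _ , _ , _ , d , d , d , d , refl) ,
    ≤-trans (≤-trans (⊓-≤ˡ _ _) (⊓-≤ˡ _ _))
            (≤-reflexive (solve 0 (con ℤ.0ℤ :+ con ℤ.0ℤ :+ con ℤ.0ℤ := con ℤ.0ℤ) refl))

  OffsetFrom : Fin m → ℝ → Fin n → ℝ → Set
  OffsetFrom e α X o = (proj₁ (ends e) ≡ X × α ≡ o) ⊎ (proj₂ (ends e) ≡ X × len e - α ≡ o)

  offset-0⇒IsVertex : ∀ {e α lo hi X} → OffsetFrom e α X 0# → IsVertex G (onEdge e α lo hi) X
  offset-0⇒IsVertex         (inj₁ (end₁≡X , α≡0))    = inj₁ (end₁≡X , α≡0)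
  offset-0⇒IsVertex {e} {α} (inj₂ (end₂≡X , len-α≡0)) = inj₂ (end₂≡X , (begin
    α                 ≡⟨ solve 2 (λ a l → a := (l :- (l :- a))) refl α (len e) ⟩
    len e - (len e - α) ≡⟨ cong (λ x → len e - x) len-α≡0 ⟩
    len e - 0#        ≡⟨ x-0≡x (len e) ⟩
    len e             ∎))
    where open ≡-Reasoning

  ConDist-viaEnds : (dist : Fin n → Fin n → ℝ) → (∀ a b → Dist G a b (dist a b)) →
                    ∀ {e α lo hi e' α' lo' hi' X X' o o'} → e ≢ e' →
                    OffsetFrom e α X o → OffsetFrom e' α' X' o' →
                    ConDistAtMost (onEdge e α lo hi) (onEdge e' α' lo' hi') (dist X X' + o + o')
  ConDist-viaEnds dist isDist {e} {α} {lo} {hi} {e'} {α'} {lo'} {hi'} e≢e' offset offset' =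
    _ , distinct-edges (_ , _ , _ , _ , isDist _ _ , isDist _ _ , isDist _ _ , isDist _ _ , refl) ,
    min≤ offset offset'
    where
    distinct-edges : ∀ {x} → GenDist G (onEdge e α lo hi) (onEdge e' α' lo' hi') x →
                     ConDist G (onEdge e α lo hi) (onEdge e' α' lo' hi') x
    distinct-edges g with e ≟ e'
    ... | yes e≡e' = ⊥-elim (e≢e' e≡e')
    ... | no  _    = g
    min≤ : ∀ {X X' o o'} → OffsetFrom e α X o → OffsetFrom e' α' X' o' →
           ((dist (proj₁ (ends e)) (proj₁ (ends e')) + α + α')
              ⊓ (dist (proj₁ (ends e)) (proj₂ (ends e')) + α + (len e' - α')))
           ⊓ ((dist (proj₂ (ends e)) (proj₁ (ends e')) + (len e - α) + α')
              ⊓ (dist (proj₂ (ends e)) (proj₂ (ends e')) + (len e - α) + (len e' - α')))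
           ≤ dist X X' + o + o'
    min≤ (inj₁ (refl , refl)) (inj₁ (refl , refl)) = ≤-trans (⊓-≤ˡ _ _) (⊓-≤ˡ _ _)
    min≤ (inj₁ (refl , refl)) (inj₂ (refl , refl)) = ≤-trans (⊓-≤ˡ _ _) (⊓-≤ʳ _ _)
    min≤ (inj₂ (refl , refl)) (inj₁ (refl , refl)) = ≤-trans (⊓-≤ʳ _ _) (⊓-≤ˡ _ _)
    min≤ (inj₂ (refl , refl)) (inj₂ (refl , refl)) = ≤-trans (⊓-≤ʳ _ _) (⊓-≤ʳ _ _)

least-satisfying : (P : ℕ → Set) → (∀ k → Dec (P k)) → ∀ {K} → P K →
                   Σ ℕ λ k → P k × (∀ j → P j → k ℕ.≤ j)
least-satisfying P P? {zero}  pK = 0 , pK , λ _ _ → ℕ.z≤n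
least-satisfying P P? {suc K} pK with P? 0
... | yes p0 = 0 , p0 , λ _ _ → ℕ.z≤n
... | no ¬p0 with least-satisfying (λ k → P (suc k)) (λ k → P? (suc k)) pK
... | k , pk , least = suc k , pk , λ { zero p0 → ⊥-elim (¬p0 p0) ; (suc j) pj → ℕ.s≤s (least j pj) }

injective⇒surjective : ∀ {k} (f : Fin k → Fin k) → (∀ {i j} → f i ≡ f j → i ≡ j) →
                       ∀ e → ∃ λ i → f i ≡ e
injective⇒surjective {suc k} f f-inj e with any? (λ i → f i ≟ e)
... | yes hit = hit
... | no miss = ⊥-elim (no-collision (pigeonhole (ℕ.n<1+n k) (λ i → punchOut (e≢f i))))
  where
  e≢f : ∀ i → e ≢ f i
  e≢f i e≡fi = miss (i , sym e≡fi)
  no-collision : ¬ ∃₂ λ i j → i Fin.< j × punchOut (e≢f i) ≡ punchOut (e≢f j)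
  no-collision (i , j , i<j , eq) = <⇒≢ i<j (f-inj (punchOut-injective (e≢f i) (e≢f j) eq))

record Rooting {{R : RealField}} {m : ℕ} (G : WGraph (suc m) m) : Set where
  field
    root                 : Fin (suc m)
    parent               : Fin (suc m) → Fin (suc m)
    parentEdge           : Fin (suc m) → Fin m
    level                : Fin (suc m) → ℕ
    level-root           : level root ≡ 0
    level≡0⇒root         : ∀ v → level v ≡ 0 → v ≡ root
    level-parent         : ∀ v → v ≢ root → suc (level (parent v)) ≡ level v
    parentEdge-joins     : ∀ v → v ≢ root → Joins G (parentEdge v) (parent v) v
    parentEdge-injective : ∀ v w → v ≢ root → w ≢ root → parentEdge v ≡ parentEdge w → v ≡ w
    parentEdge-onto      : ∀ e → ∃ λ v → v ≢ root × parentEdge v ≡ e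

-- parentEdge is injective on the |V| - 1 non-root vertices, hence onto the |V| - 1 edges.
module BreadthFirst {{R : RealField}} {m : ℕ} (G : WGraph (suc m) m) (connected : Connected G)
                    (root : Fin (suc m)) (someEdge : Fin m) where
  open WGraph G
  open Walks G

  ReachableWithin : ℕ → Fin (suc m) → Set
  ReachableWithin zero    v = v ≡ root
  ReachableWithin (suc k) v =
    ReachableWithin k v ⊎ (∃ λ e → ∃ λ w → ReachableWithin k w × Joins G e w v)

  ReachableWithin? : ∀ k v → Dec (ReachableWithin k v)
  ReachableWithin? zero    v = v ≟ root
  ReachableWithin? (suc k) v =
    ReachableWithin? k v ⊎-dec any? (λ e → any? (λ w → ReachableWithin? k w ×-dec Joins? e w v))

  walk⇒reachable : ∀ {v d} (W : Walk G root v d) → ReachableWithin (edgeCount W) v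
  walk⇒reachable []                     = refl
  walk⇒reachable (step {v = v} W e j) = inj₂ (e , v , walk⇒reachable W , j)

  levelSpec : ∀ v → Σ ℕ λ k → ReachableWithin k v × (∀ j → ReachableWithin j v → k ℕ.≤ j)
  levelSpec v = least-satisfying (λ k → ReachableWithin k v) (λ k → ReachableWithin? k v)
                  (walk⇒reachable (proj₂ (connected root v)))

  level : Fin (suc m) → ℕ
  level v = proj₁ (levelSpec v)

  reachable-level : ∀ v → ReachableWithin (level v) v
  reachable-level v = proj₁ (proj₂ (levelSpec v))

  level-least : ∀ v j → ReachableWithin j v → level v ℕ.≤ j
  level-least v = proj₂ (proj₂ (levelSpec v))

  level≡0⇒root : ∀ v → level v ≡ 0 → v ≡ root
  level≡0⇒root v eq = subst (λ k → ReachableWithin k v) eq (reachable-level v)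

  level-root : level root ≡ 0
  level-root = ℕ.n≤0⇒n≡0 (level-least root 0 refl)

  ParentOf : Fin (suc m) → Set
  ParentOf v = Σ (Fin m) λ e → Σ (Fin (suc m)) λ w → Joins G e w v × suc (level w) ≡ level v

  ParentOf? : ∀ v → Dec (ParentOf v)
  ParentOf? v = any? (λ e → any? (λ w → Joins? e w v ×-dec (suc (level w) ℕ.≟ level v)))

  parentOf : ∀ v → v ≢ root → ParentOf v
  parentOf v v≢root with level v in eq
  ... | zero  = ⊥-elim (v≢root (level≡0⇒root v eq))
  ... | suc k with subst (λ k → ReachableWithin k v) eq (reachable-level v)
  ...   | inj₁ r = ⊥-elim (ℕ.n≮n k (subst (ℕ._≤ k) eq (level-least v k r)))
  ...   | inj₂ (e , w , r , j) = e , w , j , ℕ.≤-antisym (ℕ.s≤s (level-least w k r)) v≤1+w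
    where
    v≤1+w : suc k ℕ.≤ suc (level w)
    v≤1+w = subst (ℕ._≤ suc (level w)) eq (level-least v _ (inj₂ (e , w , reachable-level w , j)))

  chosenParent : ∀ v → Dec (ParentOf v) → Fin m × Fin (suc m)
  chosenParent v (yes (e , w , _)) = e , w
  chosenParent v (no _)            = someEdge , v

  parentEdge : Fin (suc m) → Fin m
  parentEdge v = proj₁ (chosenParent v (ParentOf? v))

  parent : Fin (suc m) → Fin (suc m)
  parent v = proj₂ (chosenParent v (ParentOf? v))

  chosenParent-spec : ∀ v (d : Dec (ParentOf v)) → v ≢ root →
                      let (e , w) = chosenParent v d in Joins G e w v × suc (level w) ≡ level v
  chosenParent-spec v (yes (e , w , j , eq)) _      = j , eq
  chosenParent-spec v (no none)              v≢root = ⊥-elim (none (parentOf v v≢root))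

  parentEdge-joins : ∀ v → v ≢ root → Joins G (parentEdge v) (parent v) v
  parentEdge-joins v v≢root = proj₁ (chosenParent-spec v (ParentOf? v) v≢root)

  level-parent : ∀ v → v ≢ root → suc (level (parent v)) ≡ level v
  level-parent v v≢root = proj₂ (chosenParent-spec v (ParentOf? v) v≢root)

  parentEdge-injective : ∀ v w → v ≢ root → w ≢ root → parentEdge v ≡ parentEdge w → v ≡ w
  parentEdge-injective v w v≢root w≢root eq
    with Joins-unique (parentEdge-joins v v≢root)
                      (subst (λ e → Joins G e _ _) (sym eq) (parentEdge-joins w w≢root))
  ... | inj₁ (_ , v≡w)        = v≡w
  ... | inj₂ (pv≡w , v≡pw) =
    ⊥-elim (ℕ.<-asym (subst (λ x → level x ℕ.< level v) pv≡w (parent-lower v v≢root))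
                     (subst (λ x → level x ℕ.< level w) (sym v≡pw) (parent-lower w w≢root)))
    where
    parent-lower : ∀ x → x ≢ root → level (parent x) ℕ.< level x
    parent-lower x x≢root = ℕ.≤-reflexive (level-parent x x≢root)

  parentEdge-onto : ∀ e → ∃ λ v → v ≢ root × parentEdge v ≡ e
  parentEdge-onto e with injective⇒surjective (λ i → parentEdge (punchIn root i)) injective e
    where
    injective : ∀ {i j} → parentEdge (punchIn root i) ≡ parentEdge (punchIn root j) → i ≡ j
    injective {i} {j} eq = punchIn-injective root i j
      (parentEdge-injective _ _ (punchInᵢ≢i root i) (punchInᵢ≢i root j) eq)
  ... | i , eq = punchIn root i , punchInᵢ≢i root i , eq

  rooting : Rooting G
  rooting = record
    { root = root ; parent = parent ; parentEdge = parentEdge ; level = level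
    ; level-root = level-root ; level≡0⇒root = level≡0⇒root ; level-parent = level-parent
    ; parentEdge-joins = parentEdge-joins ; parentEdge-injective = parentEdge-injective
    ; parentEdge-onto = parentEdge-onto }

module TreeGeometry {{R : RealField}} {m : ℕ} (G : WGraph (suc m) m) (positive : PositiveLengths G)
                    (rooting : Rooting G) where
  open WGraph G
  open Walks G
  open Rooting rooting

  V : Set
  V = Fin (suc m)

  parent-induction : (P : V → Set) → P root → (∀ v → v ≢ root → P (parent v) → P v) → ∀ v → P v
  parent-induction P base extend v = go (level v) v refl
    where
    go : ∀ k v → level v ≡ k → P v
    go zero    v eq = subst P (sym (level≡0⇒root v eq)) base
    go (suc k) v eq = extend v v≢root (go k (parent v) (ℕ.suc-injective (trans (level-parent v v≢root) eq)))
      where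
      v≢root : v ≢ root
      v≢root refl = ℕ.0≢1+n (trans (sym level-root) eq)

  infix 4 _≼_
  data _≼_ (u : V) : V → Set where
    here  : u ≼ u
    there : ∀ {v} → v ≢ root → u ≼ parent v → u ≼ v

  root≼ : ∀ v → root ≼ v
  root≼ = parent-induction (root ≼_) here (λ _ v≢root r≼pv → there v≢root r≼pv)

  ≼-trans : ∀ {u v w} → u ≼ v → v ≼ w → u ≼ w
  ≼-trans u≼v here                = u≼v
  ≼-trans u≼v (there w≢root v≼pw) = there w≢root (≼-trans u≼v v≼pw)

  parent≼ : ∀ v → v ≢ root → parent v ≼ v
  parent≼ v v≢root = there v≢root here

  ≼-linear : ∀ {u w a} → u ≼ a → w ≼ a → u ≼ w ⊎ w ≼ u
  ≼-linear here               w≼a                 = inj₂ w≼a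
  ≼-linear (there a≢root u≼pa) here               = inj₁ (there a≢root u≼pa)
  ≼-linear (there _ u≼pa)      (there _ w≼pa)     = ≼-linear u≼pa w≼pa

  ≼-view : ∀ {u v} → u ≼ v → u ≡ v ⊎ (u ≼ parent v × v ≢ root)
  ≼-view here                = inj₁ refl
  ≼-view (there v≢root u≼pv) = inj₂ (u≼pv , v≢root)

  ≼-parent-if-⋠ : ∀ {u c a} → u ≼ a → c ≼ a → ¬ u ≼ c → c ≼ parent u
  ≼-parent-if-⋠ u≼a c≼a u⋠c with ≼-linear c≼a u≼a
  ... | inj₂ u≼c = ⊥-elim (u⋠c u≼c)
  ... | inj₁ c≼u with ≼-view c≼u
  ...   | inj₁ refl           = ⊥-elim (u⋠c here)
  ...   | inj₂ (c≼pu , _)     = c≼pu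

  _≼?_ : ∀ u v → Dec (u ≼ v)
  u ≼? v = parent-induction (λ v → Dec (u ≼ v)) base extend v
    where
    base : Dec (u ≼ root)
    base with u ≟ root
    ... | yes refl   = yes here
    ... | no u≢root  = no λ { here → u≢root refl ; (there root≢root _) → root≢root refl }
    extend : ∀ v → v ≢ root → Dec (u ≼ parent v) → Dec (u ≼ v)
    extend v v≢root u≼?pv with u ≟ v
    ... | yes refl = yes here
    ... | no u≢v with u≼?pv
    ...   | yes u≼pv = yes (there v≢root u≼pv)
    ...   | no  u⋠pv = no λ { here → u≢v refl ; (there _ u≼pv) → u⋠pv u≼pv }

  IsMeet : V → V → V → Set
  IsMeet a b c = c ≼ a × c ≼ b × (∀ d → d ≼ a → d ≼ b → d ≼ c)

  meetSpec : ∀ a b → Σ V (IsMeet a b)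
  meetSpec a b = parent-induction (λ a → Σ V (IsMeet a b)) base extend a
    where
    base : Σ V (IsMeet root b)
    base = root , here , root≼ b , λ _ d≼root _ → d≼root
    extend : ∀ a → a ≢ root → Σ V (IsMeet (parent a) b) → Σ V (IsMeet a b)
    extend a a≢root (c , c≼pa , c≼b , greatest) with a ≼? b
    ... | yes a≼b = a , here , a≼b , λ _ d≼a _ → d≼a
    ... | no  a⋠b = c , there a≢root c≼pa , c≼b , λ
      { _ here           d≼b → ⊥-elim (a⋠b d≼b)
      ; d (there _ d≼pa) d≼b → greatest d d≼pa d≼b }

  infixl 7 _∧_
  _∧_ : V → V → V
  a ∧ b = proj₁ (meetSpec a b)

  ∧-≼ˡ : ∀ a b → a ∧ b ≼ a
  ∧-≼ˡ a b = proj₁ (proj₂ (meetSpec a b))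

  ∧-≼ʳ : ∀ a b → a ∧ b ≼ b
  ∧-≼ʳ a b = proj₁ (proj₂ (proj₂ (meetSpec a b)))

  ∧-greatest : ∀ {a b d} → d ≼ a → d ≼ b → d ≼ a ∧ b
  ∧-greatest {a} {b} = proj₂ (proj₂ (proj₂ (meetSpec a b))) _

  ∧-≼-parents : ∀ {u w a b} → u ≼ a → w ≼ b → ¬ u ≼ w → ¬ w ≼ u → a ∧ b ≼ parent u × a ∧ b ≼ parent w
  ∧-≼-parents {u} {w} {a} {b} u≼a w≼b u⋠w w⋠u =
    ≼-parent-if-⋠ u≼a (∧-≼ˡ a b) (λ u≼a∧b → incomparable (≼-trans u≼a∧b (∧-≼ʳ a b)) w≼b) ,
    ≼-parent-if-⋠ w≼b (∧-≼ʳ a b) (λ w≼a∧b → incomparable u≼a (≼-trans w≼a∧b (∧-≼ˡ a b)))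
    where
    incomparable : ∀ {x} → u ≼ x → w ≼ x → ⊥
    incomparable u≼x w≼x with ≼-linear u≼x w≼x
    ... | inj₁ u≼w = u⋠w u≼w
    ... | inj₂ w≼u = w⋠u w≼u

  heightAt : ℕ → V → ℝ
  heightAt zero    v = 0#
  heightAt (suc k) v = heightAt k (parent v) + len (parentEdge v)

  height : V → ℝ
  height v = heightAt (level v) v

  height-root : height root ≡ 0#
  height-root = cong (λ k → heightAt k root) level-root

  height-parent : ∀ v → v ≢ root → height v ≡ height (parent v) + len (parentEdge v)
  height-parent v v≢root = cong (λ k → heightAt k v) (sym (level-parent v v≢root))

  len-nonneg : ∀ e → 0# ≤ len e
  len-nonneg e = proj₁ (positive e)

  height-mono : ∀ {u v} → u ≼ v → height u ≤ height v
  height-mono here                     = ≤-refl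
  height-mono {v = v} (there v≢root u≼pv) =
    ≤-trans (height-mono u≼pv) (≤-by-slack (len-nonneg (parentEdge v)) (height-parent v v≢root))

  height-nonneg : ∀ v → 0# ≤ height v
  height-nonneg v = subst (_≤ height v) height-root (height-mono (root≼ v))

  height≰height-parent : ∀ v → v ≢ root → ¬ height v ≤ height (parent v)
  height≰height-parent v v≢root hv≤hpv = proj₂ (positive (parentEdge v)) (≤-antisym (len-nonneg _) len≤0)
    where
    len≤0 : len (parentEdge v) ≤ 0#
    len≤0 = ≤-by-slack (slack hv≤hpv) (trans
      (solve 2 (λ p l → con ℤ.0ℤ := (l :+ (p :- (p :+ l)))) refl (height (parent v)) (len (parentEdge v)))
      (cong (λ x → len (parentEdge v) + (height (parent v) - x)) (sym (height-parent v v≢root))))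

  height≤0⇒root : ∀ v → height v ≤ 0# → v ≡ root
  height≤0⇒root v hv≤0 with v ≟ root
  ... | yes v≡root = v≡root
  ... | no  v≢root = ⊥-elim (height≰height-parent v v≢root (≤-trans hv≤0 (height-nonneg (parent v))))

  treeDist : V → V → ℝ
  treeDist a b = (height a + height b) - (height (a ∧ b) + height (a ∧ b))

  walkDown : ∀ {c b} → c ≼ b → Walk G c b (height b - height c)
  walkDown {c} here                       = walk-cast (sym (-‿inverseʳ (height c))) []
  walkDown {c} {b} (there b≢root c≼pb) =
    walk-cast eq (step (walkDown c≼pb) (parentEdge b) (parentEdge-joins b b≢root))
    where
    eq : (height (parent b) - height c) + len (parentEdge b) ≡ height b - height c
    eq = trans (solve 3 (λ p l c → ((p :- c) :+ l) := ((p :+ l) :- c)) refl _ _ _)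
               (cong (_- height c) (sym (height-parent b b≢root)))

  treeWalk : ∀ a b → Walk G a b (treeDist a b)
  treeWalk a b = walk-cast eq (reverse (walkDown (∧-≼ˡ a b)) ++ walkDown (∧-≼ʳ a b))
    where
    eq : (height a - height (a ∧ b)) + (height b - height (a ∧ b)) ≡ treeDist a b
    eq = solve 3 (λ x y c → ((x :- c) :+ (y :- c)) := ((x :+ y) :- (c :+ c))) refl _ _ _

  treeDist-common-ancestor : ∀ {a b c} → c ≼ a → c ≼ b →
                             treeDist a b ≤ (height a + height b) - (height c + height c)
  treeDist-common-ancestor {a} {b} {c} c≼a c≼b = ≤-by-slack (slack hc≤hm ⊕ slack hc≤hm)
    (solve 4 (λ x y c m → ((x :+ y) :- (c :+ c)) := (((x :+ y) :- (m :+ m)) :+ ((m :- c) :+ (m :- c))))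
           refl (height a) (height b) (height c) (height (a ∧ b)))
    where
    hc≤hm : height c ≤ height (a ∧ b)
    hc≤hm = height-mono (∧-greatest c≼a c≼b)

  treeDist-self : ∀ a → treeDist a a ≤ 0#
  treeDist-self a = ≤-trans (treeDist-common-ancestor here here)
    (≤-reflexive (solve 1 (λ x → ((x :+ x) :- (x :+ x)) := con ℤ.0ℤ) refl (height a)))

  ∧-parent≼ : ∀ a z → z ≢ root → a ∧ parent z ≼ a ∧ z
  ∧-parent≼ a z z≢root =
    ∧-greatest (∧-≼ˡ a (parent z)) (≼-trans (∧-≼ʳ a (parent z)) (parent≼ z z≢root))

  height-∧-parent : ∀ a z → z ≢ root → height (a ∧ z) ≤ height (a ∧ parent z) + len (parentEdge z)
  height-∧-parent a z z≢root with ≼-view (∧-≼ʳ a z)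
  ... | inj₁ a∧z≡z = begin
    height (a ∧ z)                               ≡⟨ cong height a∧z≡z ⟩
    height z                                     ≡⟨ height-parent z z≢root ⟩
    height (parent z) + len (parentEdge z)       ≤⟨ +-monoˡ-≤ _ (height-mono (∧-greatest pz≼a here)) ⟩
    height (a ∧ parent z) + len (parentEdge z)   ∎
    where
    open ≤-Reasoning
    pz≼a : parent z ≼ a
    pz≼a = ≼-trans (parent≼ z z≢root) (subst (_≼ a) a∧z≡z (∧-≼ˡ a z))
  ... | inj₂ (a∧z≼pz , _) = ≤-trans (height-mono (∧-greatest (∧-≼ˡ a z) a∧z≼pz))
                                    (≤-by-slack (len-nonneg (parentEdge z)) refl)

  treeDist-toParent : ∀ a z → z ≢ root → treeDist a (parent z) ≤ treeDist a z + len (parentEdge z)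
  treeDist-toParent a z z≢root = ≤-by-slack (slack bound ⊕ slack bound) (trans
    (cong (λ x → ((height a + x) - (height (a ∧ z) + height (a ∧ z))) + L) (height-parent z z≢root))
    (solve 5 (λ x p l m m' → (((x :+ (p :+ l)) :- (m :+ m)) :+ l)
                             := (((x :+ p) :- (m' :+ m')) :+ (((m' :+ l) :- m) :+ ((m' :+ l) :- m))))
           refl (height a) (height (parent z)) L (height (a ∧ z)) (height (a ∧ parent z))))
    where
    L = len (parentEdge z)
    bound : height (a ∧ z) ≤ height (a ∧ parent z) + L
    bound = height-∧-parent a z z≢root

  treeDist-toChild : ∀ a z → z ≢ root → treeDist a z ≤ treeDist a (parent z) + len (parentEdge z)
  treeDist-toChild a z z≢root = ≤-by-slack (slack bound ⊕ slack bound) (trans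
    (solve 5 (λ x p l m m' → (((x :+ p) :- (m' :+ m')) :+ l)
                             := (((x :+ (p :+ l)) :- (m :+ m)) :+ ((m :- m') :+ (m :- m'))))
           refl (height a) (height (parent z)) (len (parentEdge z)) (height (a ∧ z)) (height (a ∧ parent z)))
    (cong (λ x → ((height a + x) - (height (a ∧ z) + height (a ∧ z))) + (gap + gap))
          (sym (height-parent z z≢root))))
    where
    gap = height (a ∧ z) - height (a ∧ parent z)
    bound : height (a ∧ parent z) ≤ height (a ∧ z)
    bound = height-mono (∧-parent≼ a z z≢root)

  -- Every edge is a parent edge: this is where acyclicity of G enters.
  treeDist-edge : ∀ a {e v w} → Joins G e v w → treeDist a w ≤ treeDist a v + len e
  treeDist-edge a {e} j with parentEdge-onto e
  ... | z , z≢root , refl with Joins-unique j (parentEdge-joins z z≢root)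
  ...   | inj₁ (refl , refl) = treeDist-toChild a z z≢root
  ...   | inj₂ (refl , refl) = treeDist-toParent a z z≢root

  treeDist-shortest : ∀ {a v d} → Walk G a v d → treeDist a v ≤ d
  treeDist-shortest {a} []           = treeDist-self a
  treeDist-shortest {a} (step W e j) = ≤-trans (treeDist-edge a j) (+-monoˡ-≤ (len e) (treeDist-shortest W))

  treeDist-Dist : ∀ a b → Dist G a b (treeDist a b)
  treeDist-Dist a b = treeWalk a b , λ _ W → treeDist-shortest W

module RootPaths {{R : RealField}} {m : ℕ} (G : WGraph (suc m) m) (positive : PositiveLengths G)
                 (rooting : Rooting G) where
  open WGraph G
  open Rooting rooting
  open TreeGeometry G positive rooting
  open Continuization G

  Covers : V → ℝ → Set
  Covers u s = u ≢ root × height (parent u) ≤ s × s ≤ height u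

  len-split : ∀ {u} {s : ℝ} → Covers u s → len (parentEdge u) ≡ (height u - s) + (s - height (parent u))
  len-split {u} {s} (u≢root , _) =
    trans (solve 3 (λ p l x → l := (((p :+ l) :- x) :+ (x :- p))) refl (height (parent u)) (len (parentEdge u)) s)
          (cong (λ y → (y - s) + (s - height (parent u))) (sym (height-parent u u≢root)))

  -- The coordinate, measured from the first end of parentEdge u, of the point at height s.
  position : V → ℝ → ℝ
  position u s with proj₁ (ends (parentEdge u)) ≟ u
  ... | yes _ = height u - s
  ... | no  _ = s - height (parent u)

  position-nonneg : ∀ {u} {s : ℝ} → Covers u s → 0# ≤ position u s
  position-nonneg {u} (_ , lower , upper) with proj₁ (ends (parentEdge u)) ≟ u
  ... | yes _ = slack upper
  ... | no  _ = slack lower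

  position≤len : ∀ {u} {s : ℝ} → Covers u s → position u s ≤ len (parentEdge u)
  position≤len {u} c@(_ , lower , upper) with proj₁ (ends (parentEdge u)) ≟ u
  ... | yes _ = ≤-by-slack (slack lower) (len-split c)
  ... | no  _ = ≤-by-slack (slack upper) (trans (len-split c) (+-comm _ _))

  pointAbove : ∀ u s → Covers u s → Point G
  pointAbove u s c = onEdge (parentEdge u) (position u s) (position-nonneg c) (position≤len c)

  pointAbove-at-offset-0 : ∀ {u X} {s : ℝ} (c : Covers u s) →
                           OffsetFrom (parentEdge u) (position u s) X 0# → IsVertex G (pointAbove u s c) X
  pointAbove-at-offset-0 c = offset-0⇒IsVertex {lo = position-nonneg c} {hi = position≤len c}

  offset-from-child : ∀ {u} {s : ℝ} → Covers u s → OffsetFrom (parentEdge u) (position u s) u (height u - s)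
  offset-from-child {u} {s} c@(u≢root , _) with proj₁ (ends (parentEdge u)) ≟ u | parentEdge-joins u u≢root
  ... | yes end₁≡u | _             = inj₁ (end₁≡u , refl)
  ... | no  _      | inj₁ ends≡p,u = inj₂ (cong proj₂ ends≡p,u ,
    trans (cong (_- (s - height (parent u))) (len-split c))
          (solve 2 (λ x y → ((x :+ y) :- y) := x) refl (height u - s) (s - height (parent u))))
  ... | no  end₁≢u | inj₂ ends≡u,p = ⊥-elim (end₁≢u (cong proj₁ ends≡u,p))

  offset-from-parent : ∀ {u} {s : ℝ} → Covers u s →
                       OffsetFrom (parentEdge u) (position u s) (parent u) (s - height (parent u))
  offset-from-parent {u} {s} c@(u≢root , _) with proj₁ (ends (parentEdge u)) ≟ u | parentEdge-joins u u≢root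
  ... | no  _      | inj₁ ends≡p,u = inj₁ (cong proj₁ ends≡p,u , refl)
  ... | no  end₁≢u | inj₂ ends≡u,p = ⊥-elim (end₁≢u (cong proj₁ ends≡u,p))
  ... | yes end₁≡u | joins         = inj₂ (end₂≡p joins ,
    trans (cong (_- (height u - s)) (len-split c))
          (solve 2 (λ x y → ((x :+ y) :- x) := y) refl (height u - s) (s - height (parent u))))
    where
    end₂≡p : Joins G (parentEdge u) (parent u) u → proj₂ (ends (parentEdge u)) ≡ parent u
    end₂≡p (inj₁ ends≡p,u) = trans (cong proj₂ ends≡p,u) (trans (sym end₁≡u) (cong proj₁ ends≡p,u))
    end₂≡p (inj₂ ends≡u,p) = cong proj₂ ends≡u,p

  pointAbove-sameEdge : ∀ {u} {s s' μ : ℝ} (c : Covers u s) (c' : Covers u s') → μ ≤ s → μ ≤ s' →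
                        ConDistAtMost (pointAbove u s c) (pointAbove u s' c') ((s + s') - (μ + μ))
  pointAbove-sameEdge {u} {s} {s'} {μ} c c' μ≤s μ≤s' = _ , ConDist-sameEdge , ∣position-difference∣
    where
    ∣position-difference∣ : ∣ position u s - position u s' ∣ ≤ (s + s') - (μ + μ)
    ∣position-difference∣ with proj₁ (ends (parentEdge u)) ≟ u
    ... | yes _ = ∣-∣-≤
      (≤-by-slack (slack μ≤s ⊕ slack μ≤s)
        (solve 4 (λ x y z h → ((x :+ y) :- (z :+ z)) := (((h :- x) :- (h :- y)) :+ ((x :- z) :+ (x :- z))))
               refl s s' μ (height u)))
      (≤-by-slack (slack μ≤s' ⊕ slack μ≤s')
        (solve 4 (λ x y z h → ((x :+ y) :- (z :+ z)) := ((:- ((h :- x) :- (h :- y))) :+ ((y :- z) :+ (y :- z))))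
               refl s s' μ (height u)))
    ... | no  _ = ∣-∣-≤
      (≤-by-slack (slack μ≤s' ⊕ slack μ≤s')
        (solve 4 (λ x y z h → ((x :+ y) :- (z :+ z)) := (((x :- h) :- (y :- h)) :+ ((y :- z) :+ (y :- z))))
               refl s s' μ (height (parent u))))
      (≤-by-slack (slack μ≤s ⊕ slack μ≤s)
        (solve 4 (λ x y z h → ((x :+ y) :- (z :+ z)) := ((:- ((x :- h) :- (y :- h))) :+ ((x :- z) :+ (x :- z))))
               refl s s' μ (height (parent u))))

  pointAbove-viaAncestor : ∀ {u w X X' c} {s s' o o' : ℝ} (cu : Covers u s) (cw : Covers w s') → u ≢ w →
                           OffsetFrom (parentEdge u) (position u s) X o →
                           OffsetFrom (parentEdge w) (position w s') X' o' → c ≼ X → c ≼ X' →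
                           ConDistAtMost (pointAbove u s cu) (pointAbove w s' cw)
                                         ((height X + height X') - (height c + height c) + o + o')
  pointAbove-viaAncestor {u} {w} {o = o} {o'} cu cw u≢w offset offset' c≼X c≼X' =
    ConDistAtMost-weaken (ConDist-viaEnds treeDist treeDist-Dist edges-differ offset offset')
                         (+-monoˡ-≤ o' (+-monoˡ-≤ o (treeDist-common-ancestor c≼X c≼X')))
    where
    edges-differ : parentEdge u ≢ parentEdge w
    edges-differ eq = u≢w (parentEdge-injective u w (proj₁ cu) (proj₁ cw) eq)

  pointAbove-distance : ∀ {u w a b} {s s' μ : ℝ} (cu : Covers u s) (cw : Covers w s') → u ≼ a → w ≼ b →
                        μ ≤ s → μ ≤ s' → μ ≤ height (a ∧ b) →
                        ConDistAtMost (pointAbove u s cu) (pointAbove w s' cw) ((s + s') - (μ + μ))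
  pointAbove-distance {u} {w} {a} {b} {s} {s'} {μ} cu cw u≼a w≼b μ≤s μ≤s' μ≤hab with u ≟ w
  ... | yes refl = pointAbove-sameEdge cu cw μ≤s μ≤s'
  ... | no u≢w with u ≼? w | w ≼? u
  ...   | yes u≼w | _ with ≼-view u≼w
  ...     | inj₁ u≡w        = ⊥-elim (u≢w u≡w)
  ...     | inj₂ (u≼pw , _) = ConDistAtMost-weaken
    (pointAbove-viaAncestor cu cw u≢w (offset-from-child cu) (offset-from-parent cw) here u≼pw)
    (≤-by-slack (slack μ≤s ⊕ slack μ≤s)
      (solve 5 (λ x y z h p → ((x :+ y) :- (z :+ z))
                              := (((((h :+ p) :- (h :+ h)) :+ (h :- x)) :+ (y :- p)) :+ ((x :- z) :+ (x :- z))))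
             refl s s' μ (height u) (height (parent w))))
  pointAbove-distance {u} {w} {a} {b} {s} {s'} {μ} cu cw u≼a w≼b μ≤s μ≤s' μ≤hab
      | no u≢w | no _ | yes w≼u with ≼-view w≼u
  ...     | inj₁ w≡u        = ⊥-elim (u≢w (sym w≡u))
  ...     | inj₂ (w≼pu , _) = ConDistAtMost-weaken
    (pointAbove-viaAncestor cu cw u≢w (offset-from-parent cu) (offset-from-child cw) w≼pu here)
    (≤-by-slack (slack μ≤s' ⊕ slack μ≤s')
      (solve 5 (λ x y z h p → ((x :+ y) :- (z :+ z))
                              := (((((p :+ h) :- (h :+ h)) :+ (x :- p)) :+ (h :- y)) :+ ((y :- z) :+ (y :- z))))
             refl s s' μ (height w) (height (parent u))))
  pointAbove-distance {u} {w} {a} {b} {s} {s'} {μ} cu cw u≼a w≼b μ≤s μ≤s' μ≤hab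
      | no u≢w | no u⋠w | no w⋠u with ∧-≼-parents u≼a w≼b u⋠w w⋠u
  ...     | a∧b≼pu , a∧b≼pw = ConDistAtMost-weaken
    (pointAbove-viaAncestor cu cw u≢w (offset-from-parent cu) (offset-from-parent cw) a∧b≼pu a∧b≼pw)
    (≤-by-slack (slack μ≤hab ⊕ slack μ≤hab)
      (solve 6 (λ x y z p q c → ((x :+ y) :- (z :+ z))
                                := (((((p :+ q) :- (c :+ c)) :+ (x :- p)) :+ (y :- q)) :+ ((c :- z) :+ (c :- z))))
             refl s s' μ (height (parent u)) (height (parent w)) (height (a ∧ b))))

  locate : ∀ {s : ℝ} → 0# ≤ s → ∀ a → a ≢ root → s ≤ height a → Σ V λ u → u ≼ a × Covers u s
  locate {s} 0≤s = parent-induction (λ a → a ≢ root → s ≤ height a → Σ V λ u → u ≼ a × Covers u s)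
                                    (λ root≢root _ → ⊥-elim (root≢root refl)) extend
    where
    extend : ∀ a → a ≢ root →
             (parent a ≢ root → s ≤ height (parent a) → Σ V λ u → u ≼ parent a × Covers u s) →
             a ≢ root → s ≤ height a → Σ V λ u → u ≼ a × Covers u s
    extend a a≢root found-above _ s≤ha with height (parent a) ≤? s
    ... | yes hpa≤s = a , here , a≢root , hpa≤s , s≤ha
    ... | no  hpa≰s with found-above pa≢root (≰⇒≥ hpa≰s)
      where
      pa≢root : parent a ≢ root
      pa≢root pa≡root = hpa≰s (≤-trans (≤-reflexive (trans (cong height pa≡root) height-root)) 0≤s)
    ...   | u , u≼pa , covers = u , ≼-trans u≼pa (parent≼ a a≢root) , covers

  record PathPoint : Set where
    field
      tip          : V
      tip≢root     : tip ≢ root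
      depth        : ℝ
      depth-nonneg : 0# ≤ depth
      depth≤height : depth ≤ height tip

    located : Σ V λ u → u ≼ tip × Covers u depth
    located = locate depth-nonneg tip tip≢root depth≤height

    toPoint : Point G
    toPoint = pointAbove (proj₁ located) depth (proj₂ (proj₂ located))

  open PathPoint public using (tip; depth; toPoint)

  toPoint-distance : ∀ (P Q : PathPoint) {μ : ℝ} →
                     μ ≤ depth P → μ ≤ depth Q → μ ≤ height (tip P ∧ tip Q) →
                     ConDistAtMost (toPoint P) (toPoint Q) ((depth P + depth Q) - (μ + μ))
  toPoint-distance P Q with PathPoint.located P | PathPoint.located Q
  ... | _ , u≼a , cu | _ , w≼b , cw = pointAbove-distance cu cw u≼a w≼b

  toPoint-tip : ∀ (P : PathPoint) → depth P ≡ height (tip P) → IsVertex G (toPoint P) (tip P)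
  toPoint-tip P s≡ht with PathPoint.located P
  ... | u , u≼t , covers@(_ , _ , s≤hu) = subst (IsVertex G (pointAbove u s covers)) u≡t
    (pointAbove-at-offset-0 covers (subst (OffsetFrom _ _ u) offset≡0 (offset-from-child covers)))
    where
    t = tip P
    s = depth P
    u≡t : u ≡ t
    u≡t with ≼-view u≼t
    ... | inj₁ u≡t             = u≡t
    ... | inj₂ (u≼pt , t≢root) =
      ⊥-elim (height≰height-parent t t≢root (≤-trans (subst (_≤ height u) s≡ht s≤hu) (height-mono u≼pt)))
    offset≡0 : height u - s ≡ 0#
    offset≡0 = trans (cong₂ _-_ (cong height u≡t) s≡ht) (-‿inverseʳ _)

  toPoint-root : ∀ (P : PathPoint) → depth P ≡ 0# → IsVertex G (toPoint P) root
  toPoint-root P s≡0 with PathPoint.located P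
  ... | u , _ , covers@(_ , hpu≤s , _) = subst (IsVertex G (pointAbove u (depth P) covers)) pu≡root
    (pointAbove-at-offset-0 covers (subst (OffsetFrom _ _ (parent u)) offset≡0 (offset-from-parent covers)))
    where
    pu≡root : parent u ≡ root
    pu≡root = height≤0⇒root (parent u) (subst (height (parent u) ≤_) s≡0 hpu≤s)
    offset≡0 : depth P - height (parent u) ≡ 0#
    offset≡0 = trans (cong₂ _-_ s≡0 (trans (cong height pu≡root) height-root)) (-‿inverseʳ 0#)

module Embedding {{R : RealField}} {m : ℕ} (G : WGraph (suc m) m) (positive : PositiveLengths G)
                 (rooting : Rooting G) (someEdge : Fin m)
                 (Terminal : Fin (suc m) → Set) {k : ℕ} (F : Fin (suc m) → Fin k)
                 (distinct : ∀ t t' → Terminal t → Terminal t' → t ≢ t' → F t ≢ F t')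
                 (δ : Fin k → Fin k → ℝ) (metric : IsSemiMetric δ)
                 (δ-terminals : ∀ t t' → Terminal t → Terminal t' → Dist G t t' (δ (F t) (F t'))) where
  open Rooting rooting
  open TreeGeometry G positive rooting
  open RootPaths G positive rooting
  open Continuization G
  open SemiMetric metric
  open Walks G using (Dist-unique)

  -- Terminal need not be decidable, but its double negation is, and every fact
  -- about terminals used below is stable under double negation.
  Terminal¬¬ : V → Set
  Terminal¬¬ t = ¬ ¬ Terminal t

  Terminal¬¬? : ∀ t → Dec (Terminal¬¬ t)
  Terminal¬¬? t with weak-excluded-middle (Terminal t)
  ... | inj₁ ¬T  = no λ ¬¬T → ¬¬T ¬T
  ... | inj₂ ¬¬T = yes ¬¬T

  δ-terminal : ∀ t t' → Terminal¬¬ t → Terminal¬¬ t' → δ (F t) (F t') ≡ treeDist t t'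
  δ-terminal t t' ¬¬T ¬¬T' = decidable-stable (_ ≟ℝ _) λ ≢ →
    ¬¬T λ T → ¬¬T' λ T' → ≢ (Dist-unique (δ-terminals t t' T T') (treeDist-Dist t t'))

  F-injective-terminal : ∀ t t' → Terminal¬¬ t → Terminal¬¬ t' → F t ≡ F t' → t ≡ t'
  F-injective-terminal t t' ¬¬T ¬¬T' eq = decidable-stable (t ≟ t') λ t≢t' →
    ¬¬T λ T → ¬¬T' λ T' → distinct t t' T T' t≢t' eq

  terminal-dominated : ∀ t₁ t → Terminal¬¬ t₁ → Terminal¬¬ t → height t - δ (F t₁) (F t) ≤ height t₁
  terminal-dominated t₁ t ¬¬T₁ ¬¬T =
    subst (λ x → height t - x ≤ height t₁) (sym (δ-terminal t₁ t ¬¬T₁ ¬¬T))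
    (≤-by-slack (slack hm≤h₁ ⊕ slack hm≤h₁)
      (solve 3 (λ a b c → a := ((b :- ((a :+ b) :- (c :+ c))) :+ ((a :- c) :+ (a :- c))))
             refl (height t₁) (height t) (height (t₁ ∧ t))))
    where
    hm≤h₁ : height (t₁ ∧ t) ≤ height t₁
    hm≤h₁ = height-mono (∧-≼ˡ t₁ t)

  rootPathPoint : PathPoint
  rootPathPoint = record
    { tip = z ; tip≢root = z≢root ; depth = 0# ; depth-nonneg = ≤-refl ; depth≤height = height-nonneg z }
    where
    z = proj₁ (parentEdge-onto someEdge)
    z≢root = proj₁ (proj₂ (parentEdge-onto someEdge))

  record Anchor (C : Fin k) : Set where
    field
      point     : PathPoint
      dominates : ∀ t → Terminal¬¬ t → height t - δ C (F t) ≤ depth point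
      attained  : depth point ≡ 0# ⊎
                  (Terminal¬¬ (tip point) × depth point ≡ height (tip point) - δ C (F (tip point)))

  open Anchor

  anchor-terminal : ∀ t₁ → Terminal¬¬ t₁ → Dec (t₁ ≡ root) → Anchor (F t₁)
  anchor-terminal t₁ ¬¬T₁ (yes refl) = record
    { point     = rootPathPoint
    ; dominates = λ t ¬¬T →
        subst (height t - δ (F root) (F t) ≤_) height-root (terminal-dominated t₁ t ¬¬T₁ ¬¬T)
    ; attained  = inj₁ refl }
  anchor-terminal t₁ ¬¬T₁ (no t₁≢root) = record
    { point     = record { tip = t₁ ; tip≢root = t₁≢root ; depth = height t₁
                         ; depth-nonneg = height-nonneg t₁ ; depth≤height = ≤-refl }
    ; dominates = λ t ¬¬T → terminal-dominated t₁ t ¬¬T₁ ¬¬T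
    ; attained  = inj₂ (¬¬T₁ , sym (trans (cong (λ x → height t₁ - x) (δ-refl (F t₁)))
                                          (x-0≡x (height t₁)))) }

  anchor-generic : ∀ C → Anchor C
  anchor-generic C with argmax Terminal¬¬ Terminal¬¬? (λ t → height t - δ C (F t))
  ... | inj₂ none = record
    { point = rootPathPoint ; dominates = λ t ¬¬T → ⊥-elim (none t ¬¬T) ; attained = inj₁ refl }
  ... | inj₁ (t* , ¬¬T* , max) with (height t* - δ C (F t*)) ≤? 0#
  ...   | yes max≤0 = record
    { point = rootPathPoint ; dominates = λ t ¬¬T → ≤-trans (max t ¬¬T) max≤0 ; attained = inj₁ refl }
  ...   | no  max≰0 = record
    { point     = record { tip = t* ; tip≢root = t*≢root ; depth = height t* - δ C (F t*)
                         ; depth-nonneg = ≰⇒≥ max≰0 ; depth≤height = x-y≤x (δ-nonneg C (F t*)) }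
    ; dominates = max
    ; attained  = inj₂ (¬¬T* , refl) }
    where
    t*≢root : t* ≢ root
    t*≢root refl = max≰0 (subst (λ x → x - δ C (F root) ≤ 0#) (sym height-root) (x-y≤x (δ-nonneg C (F root))))

  TerminalCluster : Fin k → Set
  TerminalCluster C = ∃ λ t → Terminal¬¬ t × F t ≡ C

  anchorOf : ∀ C → Dec (TerminalCluster C) → Anchor C
  anchorOf .(F t₁) (yes (t₁ , ¬¬T₁ , refl)) = anchor-terminal t₁ ¬¬T₁ (t₁ ≟ root)
  anchorOf C       (no _)                   = anchor-generic C

  TerminalCluster? : ∀ C → Dec (TerminalCluster C)
  TerminalCluster? C = any? (λ t → Terminal¬¬? t ×-dec (F t ≟ C))

  anchor : ∀ C → Anchor C
  anchor C = anchorOf C (TerminalCluster? C)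

  φ : Fin k → Point G
  φ C = toPoint (point (anchor C))

  anchor-terminal-vertex : ∀ t (¬¬T : Terminal¬¬ t) d → IsVertex G (toPoint (point (anchor-terminal t ¬¬T d))) t
  anchor-terminal-vertex t ¬¬T (yes refl)   = toPoint-root _ refl
  anchor-terminal-vertex t ¬¬T (no t≢root) = toPoint-tip _ refl

  anchorOf-vertex : ∀ C t → Terminal¬¬ t → F t ≡ C → (d : Dec (TerminalCluster C)) →
                    IsVertex G (toPoint (point (anchorOf C d))) t
  anchorOf-vertex .(F t₁) t ¬¬T eq (yes (t₁ , ¬¬T₁ , refl)) with F-injective-terminal t t₁ ¬¬T ¬¬T₁ eq
  ... | refl = anchor-terminal-vertex t ¬¬T₁ (t ≟ root)
  anchorOf-vertex C t ¬¬T eq (no none) = ⊥-elim (none (t , ¬¬T , eq))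

  φ-terminal : ∀ t → Terminal t → IsVertex G (φ (F t)) t
  φ-terminal t T = anchorOf-vertex (F t) t (λ ¬T → ¬T T) refl (TerminalCluster? (F t))

  depth-nonexpansive : ∀ {C C'} (A : Anchor C) (A' : Anchor C') → depth (point A) - depth (point A') ≤ δ C C'
  depth-nonexpansive {C} {C'} A A' with attained A
  ... | inj₁ s≡0 = subst (λ x → x - depth (point A') ≤ δ C C') (sym s≡0)
    (≤-trans (x-y≤x (PathPoint.depth-nonneg (point A'))) (δ-nonneg C C'))
  ... | inj₂ (¬¬Ta , s≡) = subst (λ x → x - s' ≤ δ C C') (sym s≡)
    (≤-by-slack (slack (dominates A' a ¬¬Ta) ⊕ slack reverse-triangle)
      (solve 5 (λ h x x' s' d → d := (((h :- x) :- s') :+ ((s' :- (h :- x')) :+ (d :- (x' :- x)))))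
             refl (height a) (δ C (F a)) (δ C' (F a)) s' (δ C C')))
    where
    a = tip (point A)
    s' = depth (point A')
    reverse-triangle : δ C' (F a) - δ C (F a) ≤ δ C C'
    reverse-triangle = subst (δ C' (F a) - δ C (F a) ≤_) (δ-sym C' C) (δ-reverse-triangle C' C (F a))

  depth-sum-bound : ∀ {C C'} (A : Anchor C) (A' : Anchor C') → let g = height (tip (point A) ∧ tip (point A')) in
                    ¬ depth (point A) ≤ g → ¬ depth (point A') ≤ g →
                    (depth (point A) + depth (point A')) - (g + g) ≤ δ C C'
  depth-sum-bound {C} {C'} A A' s≰g s'≰g with attained A | attained A'
  ... | inj₁ s≡0 | _         = ⊥-elim (s≰g (subst (_≤ _) (sym s≡0) (height-nonneg _)))
  ... | inj₂ _   | inj₁ s'≡0 = ⊥-elim (s'≰g (subst (_≤ _) (sym s'≡0) (height-nonneg _)))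
  ... | inj₂ (¬¬Ta , s≡) | inj₂ (¬¬Tb , s'≡) =
    subst₂ (λ x y → (x + y) - (g + g) ≤ δ C C') (sym s≡) (sym s'≡) (≤-by-slack (slack via-terminals)
      (solve 6 (λ ha hb g x y d → d := ((((ha :- x) :+ (hb :- y)) :- (g :+ g))
                                         :+ (((x :+ d) :+ y) :- ((ha :+ hb) :- (g :+ g)))))
             refl (height a) (height b) g (δ C (F a)) (δ C' (F b)) (δ C C')))
    where
    a = tip (point A)
    b = tip (point A')
    g = height (a ∧ b)
    via-terminals : (height a + height b) - (g + g) ≤ δ C (F a) + δ C C' + δ C' (F b)
    via-terminals = subst₂ _≤_ (δ-terminal a b ¬¬Ta ¬¬Tb)
                               (cong (λ x → x + δ C C' + δ C' (F b)) (δ-sym (F a) C))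
                               (δ-triangle₃ (F a) C C' (F b))

  φ-nonexpansive : ∀ C C' → ConDistAtMost (φ C) (φ C') (δ C C')
  φ-nonexpansive C C' with sum-minus-twice-min-≤
    (subst (depth (point A') - depth (point A) ≤_) (δ-sym C' C) (depth-nonexpansive A' A))
    (depth-nonexpansive A A') (depth-sum-bound A A')
    where
    A = anchor C
    A' = anchor C'
  ... | μ , μ≤s , μ≤s' , μ≤g , bound =
    ConDistAtMost-weaken (toPoint-distance (point (anchor C)) (point (anchor C')) μ≤s μ≤s' μ≤g) bound

lemma3p14 : {{R : RealField}} (n m : ℕ) (G : WGraph n m) →
    IsTree G → PositiveLengths G →
    (T : Fin n → Set) (k : ℕ) (F : Fin n → Fin k) →
    (∀ C → ∃ λ u → F u ≡ C) →
    (∀ t t' → T t → T t' → t ≢ t' → F t ≢ F t') →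
    (δ : Fin k → Fin k → ℝ) → IsSemiMetric δ →
    (∀ t t' → T t → T t' → Dist G t t' (δ (F t) (F t'))) →
    Σ (Fin k → Point G) λ φ →
      (∀ t → T t → IsVertex G (φ (F t)) t) ×
      (∀ C C' → ∃ λ x → ConDist G (φ C) (φ C') x × x ≤ δ C C')
lemma3p14 _ zero G (_ , refl) _ _ _ _ _ _ δ metric _ =
  (λ _ → vtx Fin.zero) , (λ { Fin.zero _ → refl }) ,
  λ C C' → ConDistAtMost-weaken {vtx Fin.zero} {vtx Fin.zero} (ConDist-vtx-self no-edges) (δ-nonneg C C')
  where
  open Continuization G
  open SemiMetric metric
  no-edges : Dist G Fin.zero Fin.zero 0#
  no-edges = [] , λ { _ [] → ≤-refl ; _ (step _ () _) }
lemma3p14 _ (suc m) G (connected , refl) positive T k F _ distinct δ metric δ-terminals =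
  φ , φ-terminal , φ-nonexpansive
  where
  open Embedding G positive (BreadthFirst.rooting G connected Fin.zero Fin.zero) Fin.zero
                 T F distinct δ metric δ-terminals
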